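{- Let $L$ be a $3$-Engel Lie algebra over a field of characteristic $5$ and fix $a\in L$. For $x_1,\ldots,x_n\in L$ ($n\geq1$) put $f(x_1,\ldots,x_n)=[a,w,w]$ where $w=[x_1,\ldots,x_n]$. Then for all $x_1,\ldots,x_n\in L$ and every permutation $\sigma$ of $\{1,\ldots,n\}$, \[f(x_1,\ldots,x_n)=(-1)^{n+1}[a,x_1,x_1,x_2,x_2,\ldots,x_n,x_n]=f(x_{\sigma(1)},\ldots,x_{\sigma(n)}).\] In particular, for all $x,y,x',y',z\in L$: (i) $[f(x,y),z,z]=-f(x,y,z)$; (ii) if $f(x,y)=f(x',y')$ then $f(x,y,z)=f(x',y',z)$ and $f(z,x,y)=f(z,x',y')$; (iii) if $f(x,y)=0$ then $f(x,y,z)=0$.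
   Context: Brackets are left-normed: $[a_1,\ldots,a_n]=[\ldots[[a_1,a_2],a_3],\ldots,a_n]$. A Lie algebra $L$ is $3$-Engel if $[a,b,b,b]=0$ for all $a,b\in L$. -}

module Defs where

open import Level using (Level; _⊔_) renaming (suc to lsuc)
open import Algebra.Bundles using (CommutativeRing)
open import Algebra.Module.Bundles using (Module)
open import Data.Nat using (ℕ; zero; suc)
open import Data.Product using (∃)
open import Data.Vec.Functional using (Vector; foldl; head; tail)
open import Relation.Nullary using (¬_)

record Field (c ℓ : Level) : Set (lsuc (c ⊔ ℓ)) where
  field
    commutativeRing : CommutativeRing c ℓ
  open CommutativeRing commutativeRing public
  field
    1≉0     : ¬ (1# ≈ 0#)
    inverse : ∀ x → ¬ (x ≈ 0#) → ∃ λ y → x * y ≈ 1#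

-- Characteristic 5 (5 is prime, so in a field 5·1 = 0 means the characteristic is exactly 5).
HasChar5 : ∀ {c ℓ} → Field c ℓ → Set ℓ
HasChar5 F = 1# + 1# + 1# + 1# + 1# ≈ 0#
  where open Field F

record LieAlgebra {c ℓ : Level} (K : Field c ℓ) (m ℓm : Level)
       : Set (c ⊔ ℓ ⊔ lsuc (m ⊔ ℓm)) where
  open Field K using (commutativeRing) renaming (Carrier to Scalar)
  field
    module′ : Module commutativeRing m ℓm
  open Module module′ public
  infixl 9 ⁅_,_⁆
  field
    ⁅_,_⁆     : Carrierᴹ → Carrierᴹ → Carrierᴹ
    ⁅⁆-cong   : ∀ {x x′ y y′} → x ≈ᴹ x′ → y ≈ᴹ y′ → ⁅ x , y ⁆ ≈ᴹ ⁅ x′ , y′ ⁆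
    ⁅⁆-+ˡ     : ∀ x y z → ⁅ x +ᴹ y , z ⁆ ≈ᴹ ⁅ x , z ⁆ +ᴹ ⁅ y , z ⁆
    ⁅⁆-+ʳ     : ∀ x y z → ⁅ x , y +ᴹ z ⁆ ≈ᴹ ⁅ x , y ⁆ +ᴹ ⁅ x , z ⁆
    ⁅⁆-*ˡ     : ∀ (k : Scalar) x y → ⁅ k *ₗ x , y ⁆ ≈ᴹ k *ₗ ⁅ x , y ⁆
    ⁅⁆-*ʳ     : ∀ (k : Scalar) x y → ⁅ x , k *ₗ y ⁆ ≈ᴹ k *ₗ ⁅ x , y ⁆
    ⁅⁆-alt    : ∀ x → ⁅ x , x ⁆ ≈ᴹ 0ᴹ
    jacobi    : ∀ x y z → ⁅ ⁅ x , y ⁆ , z ⁆ +ᴹ ⁅ ⁅ y , z ⁆ , x ⁆ +ᴹ ⁅ ⁅ z , x ⁆ , y ⁆ ≈ᴹ 0ᴹ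

  Is3Engel : Set (m ⊔ ℓm)
  Is3Engel = ∀ a b → ⁅ ⁅ ⁅ a , b ⁆ , b ⁆ , b ⁆ ≈ᴹ 0ᴹ

  -- left-normed bracket [x₁,…,xₙ] of n ≥ 1 elements (indexed by Fin (suc k), n = suc k)
  lnb : ∀ {k} → Vector Carrierᴹ (suc k) → Carrierᴹ
  lnb xs = foldl ⁅_,_⁆ (head xs) (tail xs)

  fₐ : Carrierᴹ → ∀ {k} → Vector Carrierᴹ (suc k) → Carrierᴹ
  fₐ a xs = ⁅ ⁅ a , lnb xs ⁆ , lnb xs ⁆

  doubled : Carrierᴹ → ∀ {n} → Vector Carrierᴹ n → Carrierᴹ
  doubled a xs = foldl (λ u x → ⁅ ⁅ u , x ⁆ , x ⁆) a xs

  negPow : ℕ → Carrierᴹ → Carrierᴹ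
  negPow zero    u = u
  negPow (suc k) u = -ᴹ negPow k u

{-# OPTIONS --safe #-}
module Submission where

-- Linearising the Engel identity [c,v,v,v] = 0 (substitute v ± z; 2 is invertible in
-- characteristic 5) shows that [c,v,v,u] + [c,v,u,v] + [c,u,v,v] = 0.  Applying this both to
-- c and to the word [u,v,v,c], rewritten by Jacobi, gives in characteristic 5
-- [c,v,v,u] = [c,u,v,v] and [c,v,u,v] = 3[c,u,v,v].  The first identity makes the operators
-- u ↦ [u,x,x] commute pairwise; with the second, expanding [a,[w,x],[w,x]] by Jacobi gives
-- [a,[w,x],[w,x]] = -[a,w,w,x,x].  Induction along the left-normed word then yields
-- f(x₁,…,xₙ) = (-1)^(n+1) [a,x₁,x₁,…,xₙ,xₙ], whose right-hand side is symmetric in the xᵢ;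
-- (i)–(iii) are the case n = 3.

open import Defs
open import Data.Nat using (ℕ; suc)
open import Data.Product using (_×_)
open import Data.Fin.Permutation using (Permutation′; _⟨$⟩ʳ_)
open import Data.Vec.Functional using (Vector; _∷_; [])

open import Algebra.Bundles using (AbelianGroup)
open import Algebra.Module.Bundles using (Module)
open import Data.Fin using (Fin; zero; suc; punchIn)
open import Data.Fin.Permutation using (remove; punchIn-permute)
open import Data.Nat using (zero; nonZero)
open import Data.Vec using (Vec; map; lookup) renaming ([] to []ᵥ; _∷_ to _∷ᵥ_)
open import Data.Vec.Functional using (foldl)
open import Function using (_∘_)
open import Relation.Binary.Bundles using (Setoid)
open import Relation.Binary.PropositionalEquality as ≡ using (_≗_)

module AbelianGroupProperties {c ℓ} (G : AbelianGroup c ℓ) where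
  open AbelianGroup G
  open import Data.Nat using (NonZero; pred; _+_; _*_; _%_; _/_)
  open import Data.Nat.Properties using (suc-pred; *-comm)
  open import Data.Nat.DivMod using (m≡m%n+[m/n]*n)
  open import Algebra.Properties.Group group using (inverseʳ-unique)
  open import Algebra.Properties.Monoid.Mult monoid
    using (×-congˡ; ×-congʳ; ×-homo-+; ×-assocˡ) renaming (_×_ to _·_)
  open import Algebra.Properties.CommutativeMonoid.Mult commutativeMonoid using (×-distrib-+)
  open import Relation.Binary.Reasoning.Setoid setoid

  ×-zeroʳ : ∀ m → m · ε ≈ ε
  ×-zeroʳ zero    = refl
  ×-zeroʳ (suc m) = trans (identityˡ (m · ε)) (×-zeroʳ m)

  combination≈ε : ∀ j k {a b} → a ≈ ε → b ≈ ε → j · a ∙ k · b ≈ ε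
  combination≈ε j k {a} {b} a≈ε b≈ε = begin
    j · a ∙ k · b  ≈⟨ ∙-cong (×-congʳ j a≈ε) (×-congʳ k b≈ε) ⟩
    j · ε ∙ k · ε  ≈⟨ ∙-cong (×-zeroʳ j) (×-zeroʳ k) ⟩
    ε ∙ ε          ≈⟨ identityˡ ε ⟩
    ε              ∎

  -- Negation is multiplication by n - 1 and coefficients are compared modulo n, so `solve`
  -- accepts ≈-refl exactly when both sides have the same reduced normal form.
  module ExponentSolver (n : ℕ) .{{_ : NonZero n}} (exponent : ∀ x → n · x ≈ ε) where
    open import Algebra.Solver.CommutativeMonoid.Normal commutativeMonoid
      using (Normal; ⟦_⟧⇓; singleton; singleton-correct; _•_; comp-correct)

    infixl 6 _⊕_
    infixr 7 _⊛_
    infix  8 ⊝_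

    data Expr (k : ℕ) : Set where
      var : Fin k → Expr k
      _⊕_ : Expr k → Expr k → Expr k
      _⊛_ : ℕ → Expr k → Expr k
      ⊝_  : Expr k → Expr k

    ⟦_⟧ : ∀ {k} → Expr k → Vec Carrier k → Carrier
    ⟦ var i ⟧ ρ = lookup ρ i
    ⟦ e ⊕ f ⟧ ρ = ⟦ e ⟧ ρ ∙ ⟦ f ⟧ ρ
    ⟦ m ⊛ e ⟧ ρ = m · ⟦ e ⟧ ρ
    ⟦ ⊝ e   ⟧ ρ = ⟦ e ⟧ ρ ⁻¹

    ⁻¹≈pred× : ∀ x → x ⁻¹ ≈ pred n · x
    ⁻¹≈pred× x = sym (inverseʳ-unique x (pred n · x) (begin
      suc (pred n) · x  ≈⟨ ×-congˡ (suc-pred n) ⟩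
      n · x             ≈⟨ exponent x ⟩
      ε                 ∎))

    ×-mod : ∀ m x → (m % n) · x ≈ m · x
    ×-mod m x = sym (begin
      m · x                            ≈⟨ ×-congˡ (m≡m%n+[m/n]*n m n) ⟩
      (m % n + (m / n) * n) · x        ≈⟨ ×-homo-+ x (m % n) _ ⟩
      (m % n) · x ∙ ((m / n) * n) · x  ≈⟨ ∙-congˡ (×-congˡ (*-comm (m / n) n)) ⟩
      (m % n) · x ∙ (n * (m / n)) · x  ≈⟨ ∙-congˡ (sym (×-assocˡ x n (m / n))) ⟩
      (m % n) · x ∙ n · ((m / n) · x)  ≈⟨ ∙-congˡ (exponent _) ⟩
      (m % n) · x ∙ ε                  ≈⟨ identityʳ _ ⟩
      (m % n) · x                      ∎)

    scale : ∀ {k} → ℕ → Normal k → Normal k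
    scale m = map (m *_)

    normalise : ∀ {k} → Expr k → Normal k
    normalise (var i) = singleton i
    normalise (e ⊕ f) = normalise e • normalise f
    normalise (m ⊛ e) = scale m (normalise e)
    normalise (⊝ e)   = scale (pred n) (normalise e)

    reduce : ∀ {k} → Normal k → Normal k
    reduce = map (_% n)

    scale-correct : ∀ {k} m (v : Normal k) ρ → ⟦ scale m v ⟧⇓ ρ ≈ m · ⟦ v ⟧⇓ ρ
    scale-correct m []ᵥ       []ᵥ       = sym (×-zeroʳ m)
    scale-correct m (l ∷ᵥ v) (x ∷ᵥ ρ) = begin
      (m * l) · x ∙ ⟦ scale m v ⟧⇓ ρ  ≈⟨ ∙-cong (sym (×-assocˡ x m l)) (scale-correct m v ρ) ⟩
      m · (l · x) ∙ m · ⟦ v ⟧⇓ ρ      ≈⟨ sym (×-distrib-+ _ _ m) ⟩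
      m · (l · x ∙ ⟦ v ⟧⇓ ρ)          ∎

    reduce-correct : ∀ {k} (v : Normal k) ρ → ⟦ reduce v ⟧⇓ ρ ≈ ⟦ v ⟧⇓ ρ
    reduce-correct []ᵥ       []ᵥ       = refl
    reduce-correct (l ∷ᵥ v) (x ∷ᵥ ρ) = ∙-cong (×-mod l x) (reduce-correct v ρ)

    normalise-correct : ∀ {k} (e : Expr k) ρ → ⟦ normalise e ⟧⇓ ρ ≈ ⟦ e ⟧ ρ
    normalise-correct (var i) ρ = singleton-correct i ρ
    normalise-correct (e ⊕ f) ρ = trans (comp-correct (normalise e) (normalise f) ρ)
                                        (∙-cong (normalise-correct e ρ) (normalise-correct f ρ))
    normalise-correct (m ⊛ e) ρ = trans (scale-correct m (normalise e) ρ)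
                                        (×-congʳ m (normalise-correct e ρ))
    normalise-correct (⊝ e)   ρ = begin
      ⟦ scale (pred n) (normalise e) ⟧⇓ ρ  ≈⟨ scale-correct (pred n) (normalise e) ρ ⟩
      pred n · ⟦ normalise e ⟧⇓ ρ          ≈⟨ ×-congʳ (pred n) (normalise-correct e ρ) ⟩
      pred n · ⟦ e ⟧ ρ                     ≈⟨ sym (⁻¹≈pred× _) ⟩
      ⟦ e ⟧ ρ ⁻¹                           ∎

    ⟦_⇓⟧ : ∀ {k} → Expr k → Vec Carrier k → Carrier
    ⟦ e ⇓⟧ = ⟦ reduce (normalise e) ⟧⇓

    correct : ∀ {k} (e : Expr k) ρ → ⟦ e ⇓⟧ ρ ≈ ⟦ e ⟧ ρ
    correct e ρ = trans (reduce-correct (normalise e) ρ) (normalise-correct e ρ)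

    open import Relation.Binary.Reflection setoid var ⟦_⟧ ⟦_⇓⟧ correct public
      using (solve; _⊜_)

module FoldlProperties {a s x} (S : Setoid a s) {X : Set x}
    (_▷_ : Setoid.Carrier S → X → Setoid.Carrier S)
    (▷-congˡ : ∀ {u u′} y → Setoid._≈_ S u u′ → Setoid._≈_ S (u ▷ y) (u′ ▷ y)) where
  open Setoid S

  foldl-congˡ : ∀ {n u u′} (xs : Vector X n) → u ≈ u′ → foldl _▷_ u xs ≈ foldl _▷_ u′ xs
  foldl-congˡ {zero}  xs u≈u′ = u≈u′
  foldl-congˡ {suc n} xs u≈u′ = foldl-congˡ (xs ∘ suc) (▷-congˡ (xs zero) u≈u′)

  foldl-congʳ : ∀ {n} u {xs ys : Vector X n} → xs ≗ ys → foldl _▷_ u xs ≈ foldl _▷_ u ys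
  foldl-congʳ {zero}  u xs≗ys = refl
  foldl-congʳ {suc n} u xs≗ys rewrite xs≗ys zero = foldl-congʳ _ (xs≗ys ∘ suc)

  module _ (▷-comm : ∀ u y z → (u ▷ y) ▷ z ≈ (u ▷ z) ▷ y) where

    foldl-punchIn : ∀ {n} u (xs : Vector X (suc n)) j →
                    foldl _▷_ (u ▷ xs j) (xs ∘ punchIn j) ≈ foldl _▷_ u xs
    foldl-punchIn         u xs zero    = refl
    foldl-punchIn {suc n} u xs (suc j) =
      trans (foldl-congˡ (xs ∘ suc ∘ punchIn j) (▷-comm u (xs (suc j)) (xs zero)))
            (foldl-punchIn (u ▷ xs zero) (xs ∘ suc) j)

    foldl-permute : ∀ {n} u (xs : Vector X n) (σ : Permutation′ n) →
                    foldl _▷_ u (xs ∘ (σ ⟨$⟩ʳ_)) ≈ foldl _▷_ u xs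
    foldl-permute {zero}  u xs σ = refl
    foldl-permute {suc n} u xs σ = begin
      foldl _▷_ (u ▷ xs j) (xs ∘ (σ ⟨$⟩ʳ_) ∘ suc)
        ≈⟨ foldl-congʳ (u ▷ xs j) (≡.cong xs ∘ punchIn-permute σ zero) ⟩
      foldl _▷_ (u ▷ xs j) (ys ∘ (remove zero σ ⟨$⟩ʳ_))
        ≈⟨ foldl-permute (u ▷ xs j) ys (remove zero σ) ⟩
      foldl _▷_ (u ▷ xs j) ys
        ≈⟨ foldl-punchIn u xs j ⟩
      foldl _▷_ u xs ∎
      where
      open import Relation.Binary.Reasoning.Setoid S
      j = σ ⟨$⟩ʳ zero
      ys = xs ∘ punchIn j

module LieAlgebraProperties {c ℓ m ℓm} {K : Field c ℓ} (L : LieAlgebra K m ℓm) where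
  open Field K using (0#)
  open LieAlgebra L
  open import Algebra.Module.Properties module′ using (inverseˡ-uniqueᴹ; inverseʳ-uniqueᴹ; -ᴹ-involutive)
  open import Algebra.Properties.AbelianGroup +ᴹ-abelianGroup using (⁻¹-∙-comm)
  open import Algebra.Properties.Monoid.Mult +ᴹ-monoid renaming (_×_ to _·_) using ()
  open import Relation.Binary.Reasoning.Setoid ≈ᴹ-setoid

  infixl 9 ⁅_,_,_⁆ ⁅_,_,_,_⁆ ⁅_,_⁆²

  ⁅_,_,_⁆ : Carrierᴹ → Carrierᴹ → Carrierᴹ → Carrierᴹ
  ⁅ c , x , y ⁆ = ⁅ ⁅ c , x ⁆ , y ⁆

  ⁅_,_,_,_⁆ : Carrierᴹ → Carrierᴹ → Carrierᴹ → Carrierᴹ → Carrierᴹ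
  ⁅ c , x , y , z ⁆ = ⁅ ⁅ ⁅ c , x ⁆ , y ⁆ , z ⁆

  ⁅_,_⁆² : Carrierᴹ → Carrierᴹ → Carrierᴹ
  ⁅ u , x ⁆² = ⁅ ⁅ u , x ⁆ , x ⁆

  ⁅⁆-congˡ : ∀ {x x′} y → x ≈ᴹ x′ → ⁅ x , y ⁆ ≈ᴹ ⁅ x′ , y ⁆
  ⁅⁆-congˡ y x≈x′ = ⁅⁆-cong x≈x′ ≈ᴹ-refl

  ⁅⁆-congʳ : ∀ x {y y′} → y ≈ᴹ y′ → ⁅ x , y ⁆ ≈ᴹ ⁅ x , y′ ⁆
  ⁅⁆-congʳ x y≈y′ = ⁅⁆-cong ≈ᴹ-refl y≈y′

  ⁅⁆-zeroˡ : ∀ y → ⁅ 0ᴹ , y ⁆ ≈ᴹ 0ᴹ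
  ⁅⁆-zeroˡ y = begin
    ⁅ 0ᴹ , y ⁆        ≈⟨ ⁅⁆-congˡ y (*ₗ-zeroˡ 0ᴹ) ⟨
    ⁅ 0# *ₗ 0ᴹ , y ⁆  ≈⟨ ⁅⁆-*ˡ 0# 0ᴹ y ⟩
    0# *ₗ ⁅ 0ᴹ , y ⁆  ≈⟨ *ₗ-zeroˡ _ ⟩
    0ᴹ                ∎

  ⁅⁆-zeroʳ : ∀ x → ⁅ x , 0ᴹ ⁆ ≈ᴹ 0ᴹ
  ⁅⁆-zeroʳ x = begin
    ⁅ x , 0ᴹ ⁆        ≈⟨ ⁅⁆-congʳ x (*ₗ-zeroˡ 0ᴹ) ⟨
    ⁅ x , 0# *ₗ 0ᴹ ⁆  ≈⟨ ⁅⁆-*ʳ 0# x 0ᴹ ⟩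
    0# *ₗ ⁅ x , 0ᴹ ⁆  ≈⟨ *ₗ-zeroˡ _ ⟩
    0ᴹ                ∎

  ⁅⁆-negˡ : ∀ x y → ⁅ -ᴹ x , y ⁆ ≈ᴹ -ᴹ ⁅ x , y ⁆
  ⁅⁆-negˡ x y = inverseʳ-uniqueᴹ ⁅ x , y ⁆ ⁅ -ᴹ x , y ⁆ (begin
    ⁅ x , y ⁆ +ᴹ ⁅ -ᴹ x , y ⁆  ≈⟨ ⁅⁆-+ˡ x (-ᴹ x) y ⟨
    ⁅ x +ᴹ -ᴹ x , y ⁆          ≈⟨ ⁅⁆-congˡ y (-ᴹ‿inverseʳ x) ⟩
    ⁅ 0ᴹ , y ⁆                 ≈⟨ ⁅⁆-zeroˡ y ⟩
    0ᴹ                         ∎)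

  ⁅⁆-negʳ : ∀ x y → ⁅ x , -ᴹ y ⁆ ≈ᴹ -ᴹ ⁅ x , y ⁆
  ⁅⁆-negʳ x y = inverseʳ-uniqueᴹ ⁅ x , y ⁆ ⁅ x , -ᴹ y ⁆ (begin
    ⁅ x , y ⁆ +ᴹ ⁅ x , -ᴹ y ⁆  ≈⟨ ⁅⁆-+ʳ x y (-ᴹ y) ⟨
    ⁅ x , y +ᴹ -ᴹ y ⁆          ≈⟨ ⁅⁆-congʳ x (-ᴹ‿inverseʳ y) ⟩
    ⁅ x , 0ᴹ ⁆                 ≈⟨ ⁅⁆-zeroʳ x ⟩
    0ᴹ                         ∎)

  ⁅⁆-neg-congˡ : ∀ {x x′} y → x ≈ᴹ -ᴹ x′ → ⁅ x , y ⁆ ≈ᴹ -ᴹ ⁅ x′ , y ⁆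
  ⁅⁆-neg-congˡ y x≈-x′ = ≈ᴹ-trans (⁅⁆-congˡ y x≈-x′) (⁅⁆-negˡ _ y)

  ⁅⁆-+-+ : ∀ x y u v →
           ⁅ x +ᴹ y , u +ᴹ v ⁆ ≈ᴹ (⁅ x , u ⁆ +ᴹ ⁅ x , v ⁆) +ᴹ (⁅ y , u ⁆ +ᴹ ⁅ y , v ⁆)
  ⁅⁆-+-+ x y u v = ≈ᴹ-trans (⁅⁆-+ˡ x y _) (+ᴹ-cong (⁅⁆-+ʳ x u v) (⁅⁆-+ʳ y u v))

  ⁅⁆-sub : ∀ x y z → ⁅ x +ᴹ -ᴹ y , z ⁆ ≈ᴹ ⁅ x , z ⁆ +ᴹ -ᴹ ⁅ y , z ⁆
  ⁅⁆-sub x y z = ≈ᴹ-trans (⁅⁆-+ˡ x (-ᴹ y) z) (+ᴹ-congˡ (⁅⁆-negˡ y z))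

  ⁅⁆-·ˡ : ∀ k x y → ⁅ k · x , y ⁆ ≈ᴹ k · ⁅ x , y ⁆
  ⁅⁆-·ˡ zero    x y = ⁅⁆-zeroˡ y
  ⁅⁆-·ˡ (suc k) x y = ≈ᴹ-trans (⁅⁆-+ˡ x (k · x) y) (+ᴹ-congˡ (⁅⁆-·ˡ k x y))

  ⁅⁆-antisym : ∀ x y → ⁅ x , y ⁆ ≈ᴹ -ᴹ ⁅ y , x ⁆
  ⁅⁆-antisym x y = inverseˡ-uniqueᴹ ⁅ x , y ⁆ ⁅ y , x ⁆ (begin
    ⁅ x , y ⁆ +ᴹ ⁅ y , x ⁆
      ≈⟨ +ᴹ-cong (+ᴹ-identityˡ _) (+ᴹ-identityʳ _) ⟨
    (0ᴹ +ᴹ ⁅ x , y ⁆) +ᴹ (⁅ y , x ⁆ +ᴹ 0ᴹ)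
      ≈⟨ +ᴹ-cong (+ᴹ-congʳ (⁅⁆-alt x)) (+ᴹ-congˡ (⁅⁆-alt y)) ⟨
    (⁅ x , x ⁆ +ᴹ ⁅ x , y ⁆) +ᴹ (⁅ y , x ⁆ +ᴹ ⁅ y , y ⁆)
      ≈⟨ ⁅⁆-+-+ x y x y ⟨
    ⁅ x +ᴹ y , x +ᴹ y ⁆
      ≈⟨ ⁅⁆-alt (x +ᴹ y) ⟩
    0ᴹ ∎)

  ⁅⁆-jacobiʳ : ∀ c u v → ⁅ c , ⁅ u , v ⁆ ⁆ ≈ᴹ ⁅ c , u , v ⁆ +ᴹ -ᴹ ⁅ c , v , u ⁆
  ⁅⁆-jacobiʳ c u v = begin
    ⁅ c , ⁅ u , v ⁆ ⁆                        ≈⟨ ⁅⁆-antisym c _ ⟩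
    -ᴹ ⁅ ⁅ u , v ⁆ , c ⁆                     ≈⟨ -ᴹ‿cong (inverseˡ-uniqueᴹ _ _ jacobi′) ⟩
    -ᴹ -ᴹ (⁅ v , c , u ⁆ +ᴹ ⁅ c , u , v ⁆)  ≈⟨ -ᴹ-involutive _ ⟩
    ⁅ v , c , u ⁆ +ᴹ ⁅ c , u , v ⁆          ≈⟨ +ᴹ-comm _ _ ⟩
    ⁅ c , u , v ⁆ +ᴹ ⁅ v , c , u ⁆          ≈⟨ +ᴹ-congˡ (⁅⁆-neg-congˡ u (⁅⁆-antisym v c)) ⟩
    ⁅ c , u , v ⁆ +ᴹ -ᴹ ⁅ c , v , u ⁆       ∎
    where
    jacobi′ : ⁅ ⁅ u , v ⁆ , c ⁆ +ᴹ (⁅ v , c , u ⁆ +ᴹ ⁅ c , u , v ⁆) ≈ᴹ 0ᴹ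
    jacobi′ = ≈ᴹ-trans (≈ᴹ-sym (+ᴹ-assoc _ _ _)) (jacobi u v c)

  polarEngel : Carrierᴹ → Carrierᴹ → Carrierᴹ → Carrierᴹ
  polarEngel c x y = ⁅ c , x , x , y ⁆ +ᴹ ⁅ c , x , y , x ⁆ +ᴹ ⁅ c , y , x , x ⁆

  ⁅⁆³-+ : ∀ c x y → ⁅ c , x +ᴹ y , x +ᴹ y , x +ᴹ y ⁆ ≈ᴹ
          ⁅ c , x , x , x ⁆ +ᴹ polarEngel c x y +ᴹ polarEngel c y x +ᴹ ⁅ c , y , y , y ⁆
  ⁅⁆³-+ c x y = begin
    ⁅ c , x +ᴹ y , x +ᴹ y , x +ᴹ y ⁆
      ≈⟨ ⁅⁆-congˡ (x +ᴹ y) (≈ᴹ-trans (⁅⁆-congˡ (x +ᴹ y) (⁅⁆-+ʳ c x y)) (⁅⁆-+-+ _ _ x y)) ⟩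
    ⁅ (⁅ c , x , x ⁆ +ᴹ ⁅ c , x , y ⁆) +ᴹ (⁅ c , y , x ⁆ +ᴹ ⁅ c , y , y ⁆) , x +ᴹ y ⁆
      ≈⟨ ≈ᴹ-trans (⁅⁆-+ˡ _ _ _) (+ᴹ-cong (⁅⁆-+-+ _ _ x y) (⁅⁆-+-+ _ _ x y)) ⟩
    ((⁅ c , x , x , x ⁆ +ᴹ ⁅ c , x , x , y ⁆) +ᴹ (⁅ c , x , y , x ⁆ +ᴹ ⁅ c , x , y , y ⁆)) +ᴹ
    ((⁅ c , y , x , x ⁆ +ᴹ ⁅ c , y , x , y ⁆) +ᴹ (⁅ c , y , y , x ⁆ +ᴹ ⁅ c , y , y , y ⁆))
      ≈⟨ solve 8 (λ xxx xxy xyx xyy yxx yxy yyx yyy →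
                    ((xxx ⊕ xxy) ⊕ (xyx ⊕ xyy)) ⊕ ((yxx ⊕ yxy) ⊕ (yyx ⊕ yyy)) ⊜
                    ((xxx ⊕ ((xxy ⊕ xyx) ⊕ yxx)) ⊕ ((yyx ⊕ yxy) ⊕ xyy)) ⊕ yyy)
                 ≈ᴹ-refl _ _ _ _ _ _ _ _ ⟩
    ⁅ c , x , x , x ⁆ +ᴹ polarEngel c x y +ᴹ polarEngel c y x +ᴹ ⁅ c , y , y , y ⁆ ∎
    where open import Algebra.Solver.CommutativeMonoid +ᴹ-commutativeMonoid using (solve; _⊜_; _⊕_)

  polarEngel-cancel : Is3Engel → ∀ c x y → polarEngel c x y +ᴹ polarEngel c y x ≈ᴹ 0ᴹ
  polarEngel-cancel engel c x y = begin
    polarEngel c x y +ᴹ polarEngel c y x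
      ≈⟨ +ᴹ-congʳ (+ᴹ-identityˡ _) ⟨
    0ᴹ +ᴹ polarEngel c x y +ᴹ polarEngel c y x
      ≈⟨ +ᴹ-identityʳ _ ⟨
    0ᴹ +ᴹ polarEngel c x y +ᴹ polarEngel c y x +ᴹ 0ᴹ
      ≈⟨ +ᴹ-cong (+ᴹ-congʳ (+ᴹ-congʳ (engel c x))) (engel c y) ⟨
    ⁅ c , x , x , x ⁆ +ᴹ polarEngel c x y +ᴹ polarEngel c y x +ᴹ ⁅ c , y , y , y ⁆
      ≈⟨ ⁅⁆³-+ c x y ⟨
    ⁅ c , x +ᴹ y , x +ᴹ y , x +ᴹ y ⁆
      ≈⟨ engel c (x +ᴹ y) ⟩
    0ᴹ ∎

  ⁅⁆³-neg₁ : ∀ c x y z → ⁅ c , -ᴹ x , y , z ⁆ ≈ᴹ -ᴹ ⁅ c , x , y , z ⁆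
  ⁅⁆³-neg₁ c x y z = ⁅⁆-neg-congˡ z (⁅⁆-neg-congˡ y (⁅⁆-negʳ c x))

  ⁅⁆³-neg₂ : ∀ c x y z → ⁅ c , x , -ᴹ y , z ⁆ ≈ᴹ -ᴹ ⁅ c , x , y , z ⁆
  ⁅⁆³-neg₂ c x y z = ⁅⁆-neg-congˡ z (⁅⁆-negʳ _ y)

  ⁅⁆³-neg₃ : ∀ c x y z → ⁅ c , x , y , -ᴹ z ⁆ ≈ᴹ -ᴹ ⁅ c , x , y , z ⁆
  ⁅⁆³-neg₃ c x y z = ⁅⁆-negʳ _ z

  polarEngel-negʳ : ∀ c x y → polarEngel c x (-ᴹ y) ≈ᴹ -ᴹ polarEngel c x y
  polarEngel-negʳ c x y = begin
    polarEngel c x (-ᴹ y)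
      ≈⟨ +ᴹ-cong (+ᴹ-cong (⁅⁆³-neg₃ c x x y) (⁅⁆³-neg₂ c x y x)) (⁅⁆³-neg₁ c y x x) ⟩
    -ᴹ ⁅ c , x , x , y ⁆ +ᴹ -ᴹ ⁅ c , x , y , x ⁆ +ᴹ -ᴹ ⁅ c , y , x , x ⁆
      ≈⟨ +ᴹ-congʳ (⁻¹-∙-comm _ _) ⟩
    -ᴹ (⁅ c , x , x , y ⁆ +ᴹ ⁅ c , x , y , x ⁆) +ᴹ -ᴹ ⁅ c , y , x , x ⁆
      ≈⟨ ⁻¹-∙-comm _ _ ⟩
    -ᴹ polarEngel c x y
      ∎

  polarEngel-negˡ : ∀ c x y → polarEngel c (-ᴹ y) x ≈ᴹ polarEngel c y x
  polarEngel-negˡ c x y =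
    +ᴹ-cong (+ᴹ-cong (-ᴹ-cancel (⁅⁆³-neg₁ c y (-ᴹ y) x) (⁅⁆³-neg₂ c y y x))
                     (-ᴹ-cancel (⁅⁆³-neg₁ c y x (-ᴹ y)) (⁅⁆³-neg₃ c y x y)))
            (-ᴹ-cancel (⁅⁆³-neg₂ c x y (-ᴹ y)) (⁅⁆³-neg₃ c x y y))
    where
    -ᴹ-cancel : ∀ {u v w} → u ≈ᴹ -ᴹ v → v ≈ᴹ -ᴹ w → u ≈ᴹ w
    -ᴹ-cancel u≈-v v≈-w = ≈ᴹ-trans u≈-v (≈ᴹ-trans (-ᴹ‿cong v≈-w) (-ᴹ-involutive _))

  polarEngel-rotate : ∀ c u v →
    let p = ⁅ c , u , v , v ⁆; q = ⁅ c , v , u , v ⁆; r = ⁅ c , v , v , u ⁆ in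
    polarEngel u v c ≈ᴹ -ᴹ ((p +ᴹ -ᴹ q) +ᴹ -ᴹ (q +ᴹ -ᴹ r)) +ᴹ -ᴹ (p +ᴹ -ᴹ q) +ᴹ -ᴹ p
  polarEngel-rotate c u v = +ᴹ-cong (+ᴹ-cong uvvc uvcv) ucvv
    where
    c[uv]v : ⁅ c , ⁅ u , v ⁆ , v ⁆ ≈ᴹ ⁅ c , u , v , v ⁆ +ᴹ -ᴹ ⁅ c , v , u , v ⁆
    c[uv]v = ≈ᴹ-trans (⁅⁆-congˡ v (⁅⁆-jacobiʳ c u v)) (⁅⁆-sub _ _ v)

    uvvc : ⁅ u , v , v , c ⁆ ≈ᴹ -ᴹ ((⁅ c , u , v , v ⁆ +ᴹ -ᴹ ⁅ c , v , u , v ⁆) +ᴹ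
                                   -ᴹ (⁅ c , v , u , v ⁆ +ᴹ -ᴹ ⁅ c , v , v , u ⁆))
    uvvc = begin
      ⁅ u , v , v , c ⁆
        ≈⟨ ⁅⁆-antisym _ c ⟩
      -ᴹ ⁅ c , ⁅ ⁅ u , v ⁆ , v ⁆ ⁆
        ≈⟨ -ᴹ‿cong (⁅⁆-jacobiʳ c _ v) ⟩
      -ᴹ (⁅ c , ⁅ u , v ⁆ , v ⁆ +ᴹ -ᴹ ⁅ ⁅ c , v ⁆ , ⁅ u , v ⁆ ⁆)
        ≈⟨ -ᴹ‿cong (+ᴹ-cong c[uv]v (-ᴹ‿cong (⁅⁆-jacobiʳ _ u v))) ⟩
      -ᴹ ((⁅ c , u , v , v ⁆ +ᴹ -ᴹ ⁅ c , v , u , v ⁆) +ᴹ -ᴹ (⁅ c , v , u , v ⁆ +ᴹ -ᴹ ⁅ c , v , v , u ⁆))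
        ∎

    uvcv : ⁅ u , v , c , v ⁆ ≈ᴹ -ᴹ (⁅ c , u , v , v ⁆ +ᴹ -ᴹ ⁅ c , v , u , v ⁆)
    uvcv = ≈ᴹ-trans (⁅⁆-neg-congˡ v (⁅⁆-antisym _ c)) (-ᴹ‿cong c[uv]v)

    ucvv : ⁅ u , c , v , v ⁆ ≈ᴹ -ᴹ ⁅ c , u , v , v ⁆
    ucvv = ⁅⁆-neg-congˡ v (⁅⁆-neg-congˡ v (⁅⁆-antisym u c))

  ⁅⁆²-⁅⁆-expand : ∀ a w x → ⁅ a , ⁅ w , x ⁆ ⁆² ≈ᴹ
           (⁅ ⁅ a , w ⁆ , x , w , x ⁆ +ᴹ -ᴹ ⁅ ⁅ a , w ⁆ , x , x , w ⁆) +ᴹ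
           -ᴹ (⁅ ⁅ a , x ⁆ , w , w , x ⁆ +ᴹ -ᴹ ⁅ ⁅ a , x ⁆ , w , x , w ⁆)
  ⁅⁆²-⁅⁆-expand a w x = begin
    ⁅ a , ⁅ w , x ⁆ , ⁅ w , x ⁆ ⁆
      ≈⟨ ⁅⁆-congˡ _ (⁅⁆-jacobiʳ a w x) ⟩
    ⁅ ⁅ a , w , x ⁆ +ᴹ -ᴹ ⁅ a , x , w ⁆ , ⁅ w , x ⁆ ⁆
      ≈⟨ ⁅⁆-sub _ _ _ ⟩
    ⁅ ⁅ a , w , x ⁆ , ⁅ w , x ⁆ ⁆ +ᴹ -ᴹ ⁅ ⁅ a , x , w ⁆ , ⁅ w , x ⁆ ⁆
      ≈⟨ +ᴹ-cong (⁅⁆-jacobiʳ _ w x) (-ᴹ‿cong (⁅⁆-jacobiʳ _ w x)) ⟩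
    (⁅ ⁅ a , w ⁆ , x , w , x ⁆ +ᴹ -ᴹ ⁅ ⁅ a , w ⁆ , x , x , w ⁆) +ᴹ
    -ᴹ (⁅ ⁅ a , x ⁆ , w , w , x ⁆ +ᴹ -ᴹ ⁅ ⁅ a , x ⁆ , w , x , w ⁆) ∎

  ⁅⁆²-congˡ : ∀ {u u′} x → u ≈ᴹ u′ → ⁅ u , x ⁆² ≈ᴹ ⁅ u′ , x ⁆²
  ⁅⁆²-congˡ x u≈u′ = ⁅⁆-congˡ x (⁅⁆-congˡ x u≈u′)

  ⁅⁆²-negˡ : ∀ u x → ⁅ -ᴹ u , x ⁆² ≈ᴹ -ᴹ ⁅ u , x ⁆²
  ⁅⁆²-negˡ u x = ⁅⁆-neg-congˡ x (⁅⁆-negˡ u x)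

  ⁅⁆²-zeroˡ : ∀ x → ⁅ 0ᴹ , x ⁆² ≈ᴹ 0ᴹ
  ⁅⁆²-zeroˡ x = ≈ᴹ-trans (⁅⁆-congˡ x (⁅⁆-zeroˡ x)) (⁅⁆-zeroˡ x)

  -- doubled u xs is definitionally foldl ⁅_,_⁆² u xs.
  open FoldlProperties ≈ᴹ-setoid ⁅_,_⁆² ⁅⁆²-congˡ public
    using () renaming (foldl-congˡ to doubled-congˡ; foldl-permute to doubled-permute)

  doubled-neg : ∀ {n} u (xs : Vector Carrierᴹ n) → doubled (-ᴹ u) xs ≈ᴹ -ᴹ doubled u xs
  doubled-neg {zero}  u xs = ≈ᴹ-refl
  doubled-neg {suc n} u xs =
    ≈ᴹ-trans (doubled-congˡ (xs ∘ suc) (⁅⁆²-negˡ u (xs zero))) (doubled-neg _ (xs ∘ suc))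

  negPow-cong : ∀ k {u u′} → u ≈ᴹ u′ → negPow k u ≈ᴹ negPow k u′
  negPow-cong zero    u≈u′ = u≈u′
  negPow-cong (suc k) u≈u′ = -ᴹ‿cong (negPow-cong k u≈u′)

  negPow-neg : ∀ k u → negPow k (-ᴹ u) ≈ᴹ -ᴹ negPow k u
  negPow-neg zero    u = ≈ᴹ-refl
  negPow-neg (suc k) u = -ᴹ‿cong (negPow-neg k u)

module VectorSpaceProperties {c ℓ m ℓm} (K : Field c ℓ) (V : Module (Field.commutativeRing K) m ℓm) where
  open Field K using (0#; 1#; +-monoid) renaming (_+_ to _+ᴷ_; trans to ≈ᴷ-trans)
  open Module V
  open import Algebra.Properties.Monoid.Mult +ᴹ-monoid using () renaming (_×_ to _·_)
  open import Algebra.Properties.Monoid.Mult +-monoid using () renaming (_×_ to _×ᴷ_)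
  open import Algebra.Properties.Monoid.Mult.TCOptimised +-monoid using (×ᵤ≈×)
  open import Relation.Binary.Reasoning.Setoid ≈ᴹ-setoid

  ×1#-*ₗ : ∀ n x → (n ×ᴷ 1#) *ₗ x ≈ᴹ n · x
  ×1#-*ₗ zero    x = *ₗ-zeroˡ x
  ×1#-*ₗ (suc n) x = begin
    (1# +ᴷ n ×ᴷ 1#) *ₗ x         ≈⟨ *ₗ-distribʳ x 1# (n ×ᴷ 1#) ⟩
    1# *ₗ x +ᴹ (n ×ᴷ 1#) *ₗ x     ≈⟨ +ᴹ-cong (*ₗ-identityˡ x) (×1#-*ₗ n x) ⟩
    x +ᴹ n · x                    ∎

  char5⇒5·≈0 : HasChar5 K → ∀ x → 5 · x ≈ᴹ 0ᴹ
  char5⇒5·≈0 char5 x = begin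
    5 · x                ≈⟨ ×1#-*ₗ 5 x ⟨
    (5 ×ᴷ 1#) *ₗ x       ≈⟨ *ₗ-congʳ (≈ᴷ-trans (×ᵤ≈× 5 1#) char5) ⟩
    0# *ₗ x              ≈⟨ *ₗ-zeroˡ x ⟩
    0ᴹ                   ∎

module ThreeEngelChar5 {c ℓ m ℓm} {K : Field c ℓ} (L : LieAlgebra K m ℓm)
    (char5 : HasChar5 K) (engel : LieAlgebra.Is3Engel L) where
  open LieAlgebra L
  open LieAlgebraProperties L
  open VectorSpaceProperties K module′ using (char5⇒5·≈0)
  open import Algebra.Properties.Monoid.Mult +ᴹ-monoid renaming (_×_ to _·_) using (×-congʳ)
  open import Algebra.Properties.Group +ᴹ-group using (ε⁻¹≈ε)
  open import Algebra.Module.Properties module′ using (-ᴹ-involutive)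
  open import Data.Fin.Permutation using (transpose; _∘ₚ_)
  open import Relation.Binary.Reasoning.Setoid ≈ᴹ-setoid

  open AbelianGroupProperties +ᴹ-abelianGroup using (combination≈ε; module ExponentSolver)
  open ExponentSolver 5 (char5⇒5·≈0 char5)

  polarEngel≈0 : ∀ c x y → polarEngel c x y ≈ᴹ 0ᴹ
  polarEngel≈0 c x y = ≈ᴹ-trans
    (solve 2 (λ P Q → P ⊜ 3 ⊛ (P ⊕ Q) ⊕ 2 ⊛ (⊝ P ⊕ Q)) ≈ᴹ-refl P Q)
    (combination≈ε 3 2 (polarEngel-cancel engel c x y) cancel₋)
    where
    P = polarEngel c x y
    Q = polarEngel c y x

    cancel₋ : -ᴹ P +ᴹ Q ≈ᴹ 0ᴹ
    cancel₋ = ≈ᴹ-trans (+ᴹ-cong (≈ᴹ-sym (polarEngel-negʳ c x y)) (≈ᴹ-sym (polarEngel-negˡ c x y)))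
                       (polarEngel-cancel engel c x (-ᴹ y))

  module _ (c u v : Carrierᴹ) where
    private
      p = ⁅ c , u , v , v ⁆
      q = ⁅ c , v , u , v ⁆
      r = ⁅ c , v , v , u ⁆

      relation₁ : r +ᴹ q +ᴹ p ≈ᴹ 0ᴹ
      relation₁ = polarEngel≈0 c v u

      relation₂ : 2 · p +ᴹ 3 · q +ᴹ 4 · r ≈ᴹ 0ᴹ
      relation₂ = ≈ᴹ-trans
        (solve 3 (λ p q r → 2 ⊛ p ⊕ 3 ⊛ q ⊕ 4 ⊛ r ⊜ ⊝ ((p ⊕ ⊝ q) ⊕ ⊝ (q ⊕ ⊝ r)) ⊕ ⊝ (p ⊕ ⊝ q) ⊕ ⊝ p)
               ≈ᴹ-refl p q r)
        (≈ᴹ-trans (≈ᴹ-sym (polarEngel-rotate c u v)) (polarEngel≈0 u v c))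

      by-relations : ∀ {t s} j k → t ≈ᴹ s +ᴹ (j · (r +ᴹ q +ᴹ p) +ᴹ k · (2 · p +ᴹ 3 · q +ᴹ 4 · r)) → t ≈ᴹ s
      by-relations j k t≈s+combination = ≈ᴹ-trans t≈s+combination
        (≈ᴹ-trans (+ᴹ-congˡ (combination≈ε j k relation₁ relation₂)) (+ᴹ-identityʳ _))

    engel-outer : ⁅ c , v , v , u ⁆ ≈ᴹ ⁅ c , u , v , v ⁆
    engel-outer = by-relations 2 1
      (solve 3 (λ p q r → r ⊜ p ⊕ (2 ⊛ (r ⊕ q ⊕ p) ⊕ 1 ⊛ (2 ⊛ p ⊕ 3 ⊛ q ⊕ 4 ⊛ r))) ≈ᴹ-refl p q r)

    engel-middle : ⁅ c , v , u , v ⁆ ≈ᴹ 3 · ⁅ c , u , v , v ⁆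
    engel-middle = by-relations 4 4
      (solve 3 (λ p q r → q ⊜ 3 ⊛ p ⊕ (4 ⊛ (r ⊕ q ⊕ p) ⊕ 4 ⊛ (2 ⊛ p ⊕ 3 ⊛ q ⊕ 4 ⊛ r))) ≈ᴹ-refl p q r)

  ⁅⁆²-comm : ∀ u x y → ⁅ ⁅ u , x ⁆² , y ⁆² ≈ᴹ ⁅ ⁅ u , y ⁆² , x ⁆²
  ⁅⁆²-comm u x y = begin
    ⁅ ⁅ u , x ⁆ , x , y , y ⁆  ≈⟨ engel-outer ⁅ u , x ⁆ x y ⟨
    ⁅ ⁅ u , x ⁆ , y , y , x ⁆  ≈⟨ ⁅⁆-congˡ x (engel-outer u x y) ⟨
    ⁅ ⁅ u , y ⁆ , y , x , x ⁆  ∎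

  ⁅⁆²-⁅⁆ : ∀ a w x → ⁅ a , ⁅ w , x ⁆ ⁆² ≈ᴹ -ᴹ ⁅ ⁅ a , w ⁆² , x ⁆²
  ⁅⁆²-⁅⁆ a w x = begin
    ⁅ a , ⁅ w , x ⁆ ⁆²
      ≈⟨ ⁅⁆²-⁅⁆-expand a w x ⟩
    (⁅ ⁅ a , w ⁆ , x , w , x ⁆ +ᴹ -ᴹ ⁅ ⁅ a , w ⁆ , x , x , w ⁆) +ᴹ
    -ᴹ (⁅ ⁅ a , x ⁆ , w , w , x ⁆ +ᴹ -ᴹ ⁅ ⁅ a , x ⁆ , w , x , w ⁆)
      ≈⟨ +ᴹ-cong (+ᴹ-cong (engel-middle ⁅ a , w ⁆ w x) (-ᴹ‿cong (engel-outer ⁅ a , w ⁆ w x)))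
                 (-ᴹ‿cong (+ᴹ-cong awwxx (-ᴹ‿cong 3awwxx))) ⟩
    (3 · P +ᴹ -ᴹ P) +ᴹ -ᴹ (P +ᴹ -ᴹ (3 · P))
      ≈⟨ solve 1 (λ P → (3 ⊛ P ⊕ ⊝ P) ⊕ ⊝ (P ⊕ ⊝ (3 ⊛ P)) ⊜ ⊝ P) ≈ᴹ-refl P ⟩
    -ᴹ P
      ∎
    where
    P = ⁅ ⁅ a , w ⁆² , x ⁆²
    awwxx : ⁅ ⁅ a , x ⁆ , w , w , x ⁆ ≈ᴹ P
    awwxx = ⁅⁆-congˡ x (≈ᴹ-sym (engel-outer a x w))
    3awwxx : ⁅ ⁅ a , x ⁆ , w , x , w ⁆ ≈ᴹ 3 · P
    3awwxx = begin
      ⁅ ⁅ a , x ⁆ , w , x , w ⁆        ≈⟨ ⁅⁆-congˡ w (engel-middle a w x) ⟩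
      ⁅ 3 · ⁅ a , w , x , x ⁆ , w ⁆    ≈⟨ ⁅⁆-·ˡ 3 _ w ⟩
      3 · ⁅ ⁅ a , w ⁆ , x , x , w ⁆    ≈⟨ ×-congʳ 3 (engel-outer ⁅ a , w ⁆ w x) ⟩
      3 · P                            ∎

  ⁅⁆²-foldl : ∀ {k} a w (xs : Vector Carrierᴹ k) →
              ⁅ a , foldl ⁅_,_⁆ w xs ⁆² ≈ᴹ negPow k (doubled ⁅ a , w ⁆² xs)
  ⁅⁆²-foldl {zero}  a w xs = ≈ᴹ-refl
  ⁅⁆²-foldl {suc k} a w xs = begin
    ⁅ a , foldl ⁅_,_⁆ ⁅ w , xs zero ⁆ (xs ∘ suc) ⁆²
      ≈⟨ ⁅⁆²-foldl a _ (xs ∘ suc) ⟩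
    negPow k (doubled ⁅ a , ⁅ w , xs zero ⁆ ⁆² (xs ∘ suc))
      ≈⟨ negPow-cong k (doubled-congˡ (xs ∘ suc) (⁅⁆²-⁅⁆ a w (xs zero))) ⟩
    negPow k (doubled (-ᴹ ⁅ ⁅ a , w ⁆² , xs zero ⁆²) (xs ∘ suc))
      ≈⟨ negPow-cong k (doubled-neg _ (xs ∘ suc)) ⟩
    negPow k (-ᴹ doubled ⁅ ⁅ a , w ⁆² , xs zero ⁆² (xs ∘ suc))
      ≈⟨ negPow-neg k _ ⟩
    negPow (suc k) (doubled ⁅ a , w ⁆² xs) ∎

  fₐ≈negPow-doubled : ∀ a k (xs : Vector Carrierᴹ (suc k)) → fₐ a xs ≈ᴹ negPow k (doubled a xs)
  fₐ≈negPow-doubled a k xs = ⁅⁆²-foldl a (xs zero) (xs ∘ suc)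

  fₐ-permute : ∀ a k (xs : Vector Carrierᴹ (suc k)) (σ : Permutation′ (suc k)) →
               fₐ a (xs ∘ (σ ⟨$⟩ʳ_)) ≈ᴹ fₐ a xs
  fₐ-permute a k xs σ = begin
    fₐ a (xs ∘ (σ ⟨$⟩ʳ_))                 ≈⟨ fₐ≈negPow-doubled a k (xs ∘ (σ ⟨$⟩ʳ_)) ⟩
    negPow k (doubled a (xs ∘ (σ ⟨$⟩ʳ_)))  ≈⟨ negPow-cong k (doubled-permute ⁅⁆²-comm a xs σ) ⟩
    negPow k (doubled a xs)               ≈⟨ fₐ≈negPow-doubled a k xs ⟨
    fₐ a xs                               ∎

  fₐ-extendʳ : ∀ a x y z → fₐ a (x ∷ y ∷ z ∷ []) ≈ᴹ -ᴹ ⁅ fₐ a (x ∷ y ∷ []) , z ⁆²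
  fₐ-extendʳ a x y z = ⁅⁆²-⁅⁆ a ⁅ x , y ⁆ z

  ⁅fₐ,z⁆²≈-fₐ : ∀ a x y z → ⁅ fₐ a (x ∷ y ∷ []) , z ⁆² ≈ᴹ -ᴹ fₐ a (x ∷ y ∷ z ∷ [])
  ⁅fₐ,z⁆²≈-fₐ a x y z = begin
    ⁅ fₐ a (x ∷ y ∷ []) , z ⁆²        ≈⟨ -ᴹ-involutive _ ⟨
    -ᴹ -ᴹ ⁅ fₐ a (x ∷ y ∷ []) , z ⁆²  ≈⟨ -ᴹ‿cong (fₐ-extendʳ a x y z) ⟨
    -ᴹ fₐ a (x ∷ y ∷ z ∷ [])          ∎

  fₐ-extendʳ-cong : ∀ a {x y x′ y′} z → fₐ a (x ∷ y ∷ []) ≈ᴹ fₐ a (x′ ∷ y′ ∷ []) →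
                    fₐ a (x ∷ y ∷ z ∷ []) ≈ᴹ fₐ a (x′ ∷ y′ ∷ z ∷ [])
  fₐ-extendʳ-cong a {x} {y} {x′} {y′} z f≈f′ = begin
    fₐ a (x ∷ y ∷ z ∷ [])            ≈⟨ fₐ-extendʳ a x y z ⟩
    -ᴹ ⁅ fₐ a (x ∷ y ∷ []) , z ⁆²     ≈⟨ -ᴹ‿cong (⁅⁆²-congˡ z f≈f′) ⟩
    -ᴹ ⁅ fₐ a (x′ ∷ y′ ∷ []) , z ⁆²   ≈⟨ fₐ-extendʳ a x′ y′ z ⟨
    fₐ a (x′ ∷ y′ ∷ z ∷ [])          ∎

  fₐ-rotate : ∀ a x y z → fₐ a (z ∷ x ∷ y ∷ []) ≈ᴹ fₐ a (x ∷ y ∷ z ∷ [])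
  -- The permutation (0 2) ∘ₚ (0 1) reorders x y z as z x y.
  fₐ-rotate a x y z = fₐ-permute a 2 (x ∷ y ∷ z ∷ []) (transpose 0F 2F ∘ₚ transpose 0F 1F)
    where open import Data.Fin.Patterns using (0F; 1F; 2F)

  fₐ-extendˡ-cong : ∀ a {x y x′ y′} z → fₐ a (x ∷ y ∷ []) ≈ᴹ fₐ a (x′ ∷ y′ ∷ []) →
                    fₐ a (z ∷ x ∷ y ∷ []) ≈ᴹ fₐ a (z ∷ x′ ∷ y′ ∷ [])
  fₐ-extendˡ-cong a {x} {y} {x′} {y′} z f≈f′ = begin
    fₐ a (z ∷ x ∷ y ∷ [])    ≈⟨ fₐ-rotate a x y z ⟩
    fₐ a (x ∷ y ∷ z ∷ [])    ≈⟨ fₐ-extendʳ-cong a z f≈f′ ⟩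
    fₐ a (x′ ∷ y′ ∷ z ∷ [])  ≈⟨ fₐ-rotate a x′ y′ z ⟨
    fₐ a (z ∷ x′ ∷ y′ ∷ [])  ∎

  fₐ-extendʳ-zero : ∀ a {x y} z → fₐ a (x ∷ y ∷ []) ≈ᴹ 0ᴹ → fₐ a (x ∷ y ∷ z ∷ []) ≈ᴹ 0ᴹ
  fₐ-extendʳ-zero a {x} {y} z f≈0 = begin
    fₐ a (x ∷ y ∷ z ∷ [])          ≈⟨ fₐ-extendʳ a x y z ⟩
    -ᴹ ⁅ fₐ a (x ∷ y ∷ []) , z ⁆²   ≈⟨ -ᴹ‿cong (≈ᴹ-trans (⁅⁆²-congˡ z f≈0) (⁅⁆²-zeroˡ z)) ⟩
    -ᴹ 0ᴹ                          ≈⟨ ε⁻¹≈ε ⟩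
    0ᴹ                             ∎

mainTheorem5 : ∀ {c ℓ m ℓm} (K : Field c ℓ) (L : LieAlgebra K m ℓm) →
    HasChar5 K → LieAlgebra.Is3Engel L →
    let open LieAlgebra L in
    ∀ (a : Carrierᴹ) →
      (∀ (k : ℕ) (xs : Vector Carrierᴹ (suc k)) (σ : Permutation′ (suc k)) →
         (fₐ a xs ≈ᴹ negPow k (doubled a xs))
         × (negPow k (doubled a xs) ≈ᴹ fₐ a (λ i → xs (σ ⟨$⟩ʳ i))))
      × (∀ x y z → ⁅ ⁅ fₐ a (x ∷ y ∷ []) , z ⁆ , z ⁆ ≈ᴹ -ᴹ fₐ a (x ∷ y ∷ z ∷ []))
      × (∀ x y x′ y′ z → fₐ a (x ∷ y ∷ []) ≈ᴹ fₐ a (x′ ∷ y′ ∷ []) →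
           (fₐ a (x ∷ y ∷ z ∷ []) ≈ᴹ fₐ a (x′ ∷ y′ ∷ z ∷ []))
           × (fₐ a (z ∷ x ∷ y ∷ []) ≈ᴹ fₐ a (z ∷ x′ ∷ y′ ∷ [])))
      × (∀ x y z → fₐ a (x ∷ y ∷ []) ≈ᴹ 0ᴹ → fₐ a (x ∷ y ∷ z ∷ []) ≈ᴹ 0ᴹ)
mainTheorem5 K L char5 engel a =
    (λ k xs σ → fₐ≈negPow-doubled a k xs , negPow-doubled≈fₐ-permuted k xs σ)
  , ⁅fₐ,z⁆²≈-fₐ a
  , (λ x y x′ y′ z f≈f′ → fₐ-extendʳ-cong a z f≈f′ , fₐ-extendˡ-cong a z f≈f′)
  , (λ x y z → fₐ-extendʳ-zero a z)
  where
  open import Data.Product using (_,_)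
  open LieAlgebra L
  open ThreeEngelChar5 L char5 engel

  negPow-doubled≈fₐ-permuted : ∀ k (xs : Vector Carrierᴹ (suc k)) (σ : Permutation′ (suc k)) →
                               negPow k (doubled a xs) ≈ᴹ fₐ a (xs ∘ (σ ⟨$⟩ʳ_))
  negPow-doubled≈fₐ-permuted k xs σ =
    ≈ᴹ-trans (≈ᴹ-sym (fₐ≈negPow-doubled a k xs)) (≈ᴹ-sym (fₐ-permute a k xs σ))
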